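{- Let $\{(u_i,v_i)\}_{i=1}^m$ be a sequence of edge insertions into an initially empty forest, each joining two distinct trees. Then $\sum_{i=1}^m \min\{\deg_{i-1}(u_i),\deg_{i-1}(v_i)\}\le m$, where $\deg_{i-1}(\cdot)$ denotes the degree in the forest just before the $i$-th insertion. -}

module Defs where

open import Data.Nat using (ℕ; zero; suc; _+_; _⊔_; _⊓_)
open import Data.Fin using (Fin; toℕ; _≟_)
open import Data.Product using (_×_; _,_; proj₁; proj₂)
open import Data.Sum using (_⊎_)
open import Data.List using (List; []; _∷_; length; lookup; take; allFin; map)
open import Data.Nat.ListAction using (sum)
open import Data.List.Membership.Propositional using (_∈_)
open import Relation.Nullary using (¬_; yes; no)

Edge : ℕ → Set
Edge n = Fin n × Fin n

Graph : ℕ → Set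
Graph n = List (Edge n)

Adj : ∀ {n} → Graph n → Fin n → Fin n → Set
Adj G u v = ((u , v) ∈ G) ⊎ ((v , u) ∈ G)

data Connected {n : ℕ} (G : Graph n) : Fin n → Fin n → Set where
  here : ∀ {u} → Connected G u u
  step : ∀ {u w v} → Adj G u w → Connected G w v → Connected G u v

ind : ∀ {n} → Fin n → Fin n → ℕ
ind x y with x ≟ y
... | yes _ = 1
... | no _  = 0

deg : ∀ {n} → Graph n → Fin n → ℕ
deg [] x = 0
deg ((a , b) ∷ G) x = ind x a + ind x b + deg G x

-- Forest just before the i-th insertion (0-indexed i): the first i edges.
before : ∀ {n} (es : List (Edge n)) → Fin (length es) → Graph n
before es i = take (toℕ i) es

ValidInsertions : ∀ {n} → List (Edge n) → Set
ValidInsertions es = ∀ (i : Fin (length es)) →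
  ¬ Connected (before es i) (proj₁ (lookup es i)) (proj₂ (lookup es i))

cost : ∀ {n} (es : List (Edge n)) → Fin (length es) → ℕ
cost es i = deg (before es i) (proj₁ (lookup es i)) ⊓ deg (before es i) (proj₂ (lookup es i))

totalCost : ∀ {n} → List (Edge n) → ℕ
totalCost es = sum (map (cost es) (allFin (length es)))

{-# OPTIONS --safe #-}
module Submission where

-- Take as potential the sum, over the trees of the forest, of their maximum degree; trees are
-- tracked by a labelling of the vertices that is merged along with them. Joining the trees of
-- u and v, of maximum degrees Mᵤ ≥ deg u and Mᵥ ≥ deg v, gives a tree of maximum degree at most
-- 1 + Mᵤ ⊔ Mᵥ, so the cost deg u ⊓ deg v plus the increase of the potential is at most
-- Mᵤ ⊓ Mᵥ + Mᵤ ⊔ Mᵥ + 1 − Mᵤ − Mᵥ = 1. The potential starts at 0 and is never negative.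

open import Defs
open import Data.Bool using (if_then_else_)
open import Data.Empty using (⊥-elim)
open import Data.Fin using (Fin; zero; suc; toℕ; _≟_)
open import Data.List using (List; []; _∷_; length; lookup; take; tabulate; _++_)
open import Data.List.Properties using (++-assoc; ++-identityʳ; map-tabulate; tabulate-cong)
open import Data.List.Membership.Propositional.Properties using (∈-++⁺ˡ; ∈-++⁺ʳ)
open import Data.List.Relation.Unary.Any using (here)
open import Data.Nat using (ℕ; zero; suc; _+_; _≤_; _⊔_; _⊓_; z≤n; s≤s)
open import Data.Nat.ListAction using (sum)
open import Data.Nat.Properties hiding (_≟_)
open import Algebra.Properties.Monoid.Sum +-0-monoid using (sum-replicate-zero) renaming (sum to ∑)
open import Data.Nat.Tactic.RingSolver using (solve-∀)
open import Data.Product using (_×_; _,_; proj₁; proj₂)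
open import Data.Sum using (_⊎_; inj₁; inj₂)
open import Data.Vec.Functional using (Vector; foldr; updateAt)
open import Data.Vec.Functional.Properties using (updateAt-updates; updateAt-minimal)
open import Function using (_∘_; id; const)
open import Relation.Binary.PropositionalEquality
open import Relation.Nullary using (¬_; Dec; yes; no; does)
open import Relation.Nullary.Decidable using (dec-true)

private
  variable
    n : ℕ
    G : Graph n
    u v x y z : Fin n

Adj-sym : Adj G x y → Adj G y x
Adj-sym (inj₁ xy∈G) = inj₂ xy∈G
Adj-sym (inj₂ yx∈G) = inj₁ yx∈G

Connected-trans : Connected G x y → Connected G y z → Connected G x z
Connected-trans here         q = q
Connected-trans (step xw wy) q = step xw (Connected-trans wy q)

Connected-sym : Connected G x y → Connected G y x
Connected-sym here         = here
Connected-sym (step xw wy) = Connected-trans (Connected-sym wy) (step (Adj-sym xw) here)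

Connected-++⁺ˡ : ∀ H → Connected G x y → Connected (G ++ H) x y
Connected-++⁺ˡ H here                  = here
Connected-++⁺ˡ H (step (inj₁ xw) wy) = step (inj₁ (∈-++⁺ˡ xw)) (Connected-++⁺ˡ H wy)
Connected-++⁺ˡ H (step (inj₂ wx) wy) = step (inj₂ (∈-++⁺ˡ wx)) (Connected-++⁺ˡ H wy)

Connected-snoc : ∀ (G : Graph n) u v → Connected (G ++ (u , v) ∷ []) u v
Connected-snoc G u v = step (inj₁ (∈-++⁺ʳ G (here refl))) here

ind-≡ : ∀ (x : Fin n) → ind x x ≡ 1
ind-≡ x with x ≟ x
... | yes _   = refl
... | no x≢x = ⊥-elim (x≢x refl)

ind-≢ : x ≢ y → ind x y ≡ 0
ind-≢ {x = x} {y} x≢y with x ≟ y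
... | yes x≡y = ⊥-elim (x≢y x≡y)
... | no _    = refl

ind≤1 : ∀ (x y : Fin n) → ind x y ≤ 1
ind≤1 x y with x ≟ y
... | yes _ = s≤s z≤n
... | no _  = z≤n

deg-snoc : ∀ (G : Graph n) u v x → deg (G ++ (u , v) ∷ []) x ≡ deg G x + (ind x u + ind x v)
deg-snoc []            u v x = +-identityʳ _
deg-snoc ((a , b) ∷ G) u v x =
  trans (cong (ind x a + ind x b +_) (deg-snoc G u v x)) (sym (+-assoc (ind x a + ind x b) _ _))

deg-snoc-≤ : ∀ (G : Graph n) → u ≢ v → ∀ x → deg (G ++ (u , v) ∷ []) x ≤ suc (deg G x)
deg-snoc-≤ {u = u} {v} G u≢v x = begin
  deg (G ++ (u , v) ∷ []) x     ≡⟨ deg-snoc G u v x ⟩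
  deg G x + (ind x u + ind x v) ≤⟨ +-monoʳ-≤ (deg G x) (new-endpoints x (x ≟ u)) ⟩
  deg G x + 1                   ≡⟨ +-comm (deg G x) 1 ⟩
  suc (deg G x)                 ∎
  where
    open ≤-Reasoning
    new-endpoints : ∀ x → Dec (x ≡ u) → ind x u + ind x v ≤ 1
    new-endpoints x (yes refl) = ≤-reflexive (cong₂ _+_ (ind-≡ x) (ind-≢ u≢v))
    new-endpoints x (no x≢u)   = subst (_≤ 1) (cong (_+ ind x v) (sym (ind-≢ x≢u))) (ind≤1 x v)

deg-snoc-≢ : ∀ (G : Graph n) → x ≢ u → x ≢ v → deg (G ++ (u , v) ∷ []) x ≡ deg G x
deg-snoc-≢ {x = x} {u} {v} G x≢u x≢v = begin
  deg (G ++ (u , v) ∷ []) x     ≡⟨ deg-snoc G u v x ⟩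
  deg G x + (ind x u + ind x v) ≡⟨ cong (deg G x +_) (cong₂ _+_ (ind-≢ x≢u) (ind-≢ x≢v)) ⟩
  deg G x + 0                   ≡⟨ +-identityʳ _ ⟩
  deg G x                       ∎
  where open ≡-Reasoning

∑-mono-≤ : ∀ {f g : Vector ℕ n} → (∀ i → f i ≤ g i) → ∑ f ≤ ∑ g
∑-mono-≤ {zero}  f≤g = z≤n
∑-mono-≤ {suc n} f≤g = +-mono-≤ (f≤g zero) (∑-mono-≤ (f≤g ∘ suc))

∑-updateAt : ∀ (f : Vector ℕ n) i (h : ℕ → ℕ) → ∑ (updateAt f i h) + f i ≡ ∑ f + h (f i)
∑-updateAt f zero h = swap (h (f zero)) (∑ (f ∘ suc)) (f zero)
  where
    swap : ∀ a b c → a + b + c ≡ c + b + a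
    swap = solve-∀
∑-updateAt f (suc i) h = begin
  f zero + ∑ (updateAt (f ∘ suc) i h) + f (suc i)   ≡⟨ +-assoc (f zero) _ _ ⟩
  f zero + (∑ (updateAt (f ∘ suc) i h) + f (suc i)) ≡⟨ cong (f zero +_) (∑-updateAt (f ∘ suc) i h) ⟩
  f zero + (∑ (f ∘ suc) + h (f (suc i)))            ≡⟨ +-assoc (f zero) _ _ ⟨
  f zero + ∑ (f ∘ suc) + h (f (suc i))              ∎
  where open ≡-Reasoning

⨆ : Vector ℕ n → ℕ
⨆ = foldr _⊔_ 0

≤-⨆ : ∀ (f : Vector ℕ n) i → f i ≤ ⨆ f
≤-⨆ f zero    = m≤m⊔n _ _
≤-⨆ f (suc i) = m≤n⇒m≤o⊔n (f zero) (≤-⨆ (f ∘ suc) i)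

⨆-lub : ∀ {f : Vector ℕ n} {b} → (∀ i → f i ≤ b) → ⨆ f ≤ b
⨆-lub {zero}  f≤b = z≤n
⨆-lub {suc n} f≤b = ⊔-lub (f≤b zero) (⨆-lub (f≤b ∘ suc))

classMax : (Fin n → Fin n) → (Fin n → ℕ) → Fin n → ℕ
classMax κ D c = ⨆ (λ x → if does (κ x ≟ c) then D x else 0)

≤-classMax : ∀ κ (D : Fin n → ℕ) {x c} → κ x ≡ c → D x ≤ classMax κ D c
≤-classMax κ D {x} {c} κx≡c =
  subst (_≤ classMax κ D c) (cong (if_then D x else 0) (dec-true (κ x ≟ c) κx≡c)) (≤-⨆ _ x)

classMax-lub : ∀ κ (D : Fin n → ℕ) {c b} → (∀ x → κ x ≡ c → D x ≤ b) → classMax κ D c ≤ b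
classMax-lub κ D {c} {b} bound = ⨆-lub (λ x → restricted x (κ x ≟ c))
  where
    restricted : ∀ x (κx≟c : Dec (κ x ≡ c)) → (if does κx≟c then D x else 0) ≤ b
    restricted x (yes κx≡c) = bound x κx≡c
    restricted x (no _)     = z≤n

-- Only this direction is needed: labels serve to tell the trees of u and v apart.
ConnectedClasses : Graph n → (Fin n → Fin n) → Set
ConnectedClasses G κ = ∀ {x y} → κ x ≡ κ y → Connected G x y

potential : Graph n → (Fin n → Fin n) → ℕ
potential G κ = ∑ (classMax κ (deg G))

merge : (Fin n → Fin n) → Fin n → Fin n → Fin n → Fin n
merge κ u v x = if does (κ x ≟ κ v) then κ u else κ x

merge-cases : ∀ (κ : Fin n → Fin n) u v x →
              (κ x ≡ κ v × merge κ u v x ≡ κ u) ⊎ (κ x ≢ κ v × merge κ u v x ≡ κ x)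
merge-cases κ u v x with κ x ≟ κ v
... | yes κx≡κv = inj₁ (κx≡κv , refl)
... | no κx≢κv  = inj₂ (κx≢κv , refl)

ConnectedClasses-merge : ∀ {κ} → ConnectedClasses G κ →
                         ConnectedClasses (G ++ (u , v) ∷ []) (merge κ u v)
ConnectedClasses-merge {G = G} {u} {v} {κ} classes {x} {y} eq
  with merge-cases κ u v x | merge-cases κ u v y
... | inj₁ (κx≡κv , _) | inj₁ (κy≡κv , _) =
  Connected-++⁺ˡ _ (classes {x} {y} (trans κx≡κv (sym κy≡κv)))
... | inj₁ (κx≡κv , κ′x≡κu) | inj₂ (_ , κ′y≡κy) =
  Connected-trans (Connected-++⁺ˡ _ (classes {x} {v} κx≡κv))
    (Connected-trans (Connected-sym (Connected-snoc G u v))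
      (Connected-++⁺ˡ _ (classes {u} {y} (trans (sym κ′x≡κu) (trans eq κ′y≡κy)))))
... | inj₂ (_ , κ′x≡κx) | inj₁ (κy≡κv , κ′y≡κu) =
  Connected-trans (Connected-++⁺ˡ _ (classes {x} {u} (trans (sym κ′x≡κx) (trans eq κ′y≡κu))))
    (Connected-trans (Connected-snoc G u v) (Connected-++⁺ˡ _ (classes {v} {y} (sym κy≡κv))))
... | inj₂ (_ , κ′x≡κx) | inj₂ (_ , κ′y≡κy) =
  Connected-++⁺ˡ _ (classes {x} {y} (trans (sym κ′x≡κx) (trans eq κ′y≡κy)))

classMax-merge-absorbed : ∀ κ (D : Fin n → ℕ) → κ u ≢ κ v → classMax (merge κ u v) D (κ v) ≤ 0
classMax-merge-absorbed {u = u} {v} κ D κu≢κv = classMax-lub (merge κ u v) D absorbed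
  where
    absorbed : ∀ x → merge κ u v x ≡ κ v → D x ≤ 0
    absorbed x κ′x≡κv with merge-cases κ u v x
    ... | inj₁ (_ , κ′x≡κu)     = ⊥-elim (κu≢κv (trans (sym κ′x≡κu) κ′x≡κv))
    ... | inj₂ (κx≢κv , κ′x≡κx) = ⊥-elim (κx≢κv (trans (sym κ′x≡κx) κ′x≡κv))

classMax-merge-target : ∀ κ (D D′ : Fin n → ℕ) → (∀ x → D′ x ≤ suc (D x)) →
  classMax (merge κ u v) D′ (κ u) ≤ suc (classMax κ D (κ u) ⊔ classMax κ D (κ v))
classMax-merge-target {u = u} {v} κ D D′ D′≤1+D = classMax-lub (merge κ u v) D′ merged
  where
    merged : ∀ x → merge κ u v x ≡ κ u → D′ x ≤ suc (classMax κ D (κ u) ⊔ classMax κ D (κ v))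
    merged x κ′x≡κu with merge-cases κ u v x
    ... | inj₁ (κx≡κv , _) =
      ≤-trans (D′≤1+D x) (s≤s (m≤n⇒m≤o⊔n _ (≤-classMax κ D κx≡κv)))
    ... | inj₂ (_ , κ′x≡κx) =
      ≤-trans (D′≤1+D x) (s≤s (m≤n⇒m≤n⊔o _ (≤-classMax κ D (trans (sym κ′x≡κx) κ′x≡κu))))

classMax-merge-other : ∀ κ (D D′ : Fin n → ℕ) {c} → c ≢ κ u → c ≢ κ v →
  (∀ x → x ≢ u → x ≢ v → D′ x ≡ D x) → classMax (merge κ u v) D′ c ≤ classMax κ D c
classMax-merge-other {u = u} {v} κ D D′ {c} c≢κu c≢κv D′≡D = classMax-lub (merge κ u v) D′ untouched
  where
    untouched : ∀ x → merge κ u v x ≡ c → D′ x ≤ classMax κ D c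
    untouched x κ′x≡c with merge-cases κ u v x
    ... | inj₁ (_ , κ′x≡κu) = ⊥-elim (c≢κu (trans (sym κ′x≡c) κ′x≡κu))
    ... | inj₂ (_ , κ′x≡κx) =
      subst (_≤ classMax κ D c) (sym (D′≡D x x≢u x≢v)) (≤-classMax κ D κx≡c)
      where
        κx≡c : κ x ≡ c
        κx≡c = trans (sym κ′x≡κx) κ′x≡c
        x≢u : x ≢ u
        x≢u refl = c≢κu (sym κx≡c)
        x≢v : x ≢ v
        x≢v refl = c≢κv (sym κx≡c)

∑-merge-≤ : ∀ (M M′ : Vector ℕ n) {a b B} → b ≢ a → M′ a ≤ B → M′ b ≤ 0 →
            (∀ c → c ≢ a → c ≢ b → M′ c ≤ M c) → ∑ M′ + M b + M a ≤ ∑ M + B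
∑-merge-≤ M M′ {a} {b} {B} b≢a M′a≤B M′b≤0 M′≤M = begin
  ∑ M′ + M b + M a   ≤⟨ +-monoˡ-≤ (M a) (+-monoˡ-≤ (M b) (∑-mono-≤ λ c → M′≤M₂ c (c ≟ b) (c ≟ a))) ⟩
  ∑ M₂ + M b + M a   ≡⟨ cong (λ t → ∑ M₂ + t + M a) (updateAt-minimal b a M b≢a) ⟨
  ∑ M₂ + M₁ b + M a  ≡⟨ cong (_+ M a) (∑-updateAt M₁ b (const 0)) ⟩
  ∑ M₁ + 0 + M a     ≡⟨ cong (_+ M a) (+-identityʳ (∑ M₁)) ⟩
  ∑ M₁ + M a         ≡⟨ ∑-updateAt M a (const B) ⟩
  ∑ M + B            ∎
  where
    open ≤-Reasoning
    M₁ M₂ : Vector ℕ _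
    M₁ = updateAt M a (const B)
    M₂ = updateAt M₁ b (const 0)
    M′≤M₂ : ∀ c → Dec (c ≡ b) → Dec (c ≡ a) → M′ c ≤ M₂ c
    M′≤M₂ c (yes refl) _ = subst (M′ b ≤_) (sym (updateAt-updates b M₁)) M′b≤0
    M′≤M₂ c (no c≢b) (yes refl) =
      subst (M′ a ≤_) (sym (trans (updateAt-minimal a b M₁ c≢b) (updateAt-updates a M))) M′a≤B
    M′≤M₂ c (no c≢b) (no c≢a) =
      subst (M′ c ≤_) (sym (trans (updateAt-minimal c b M₁ c≢b) (updateAt-minimal c a M c≢a)))
        (M′≤M c c≢a c≢b)

⊓-+-⊔-≤ : ∀ {a b c d} → a ≤ c → b ≤ d → a ⊓ b + (c ⊔ d) ≤ c + d
⊓-+-⊔-≤ {a} {b} {c} {d} a≤c b≤d = begin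
  a ⊓ b + (c ⊔ d)           ≡⟨ +-distribˡ-⊔ (a ⊓ b) c d ⟩
  (a ⊓ b + c) ⊔ (a ⊓ b + d) ≤⟨ ⊔-lub (≤-trans (+-monoˡ-≤ c a⊓b≤d) (≤-reflexive (+-comm d c)))
                                     (+-monoˡ-≤ d a⊓b≤c) ⟩
  c + d                     ∎
  where
    open ≤-Reasoning
    a⊓b≤c : a ⊓ b ≤ c
    a⊓b≤c = ≤-trans (m⊓n≤m a b) a≤c
    a⊓b≤d : a ⊓ b ≤ d
    a⊓b≤d = ≤-trans (m⊓n≤n a b) b≤d

edgeCost : Graph n → Edge n → ℕ
edgeCost G e = deg G (proj₁ e) ⊓ deg G (proj₂ e)

potential-merge : ∀ {κ} → ConnectedClasses G κ → ¬ Connected G u v →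
  edgeCost G (u , v) + potential (G ++ (u , v) ∷ []) (merge κ u v) ≤ suc (potential G κ)
potential-merge {G = G} {u} {v} {κ} classes u≁v = +-cancelʳ-≤ (Mv + Mu) _ _ (begin
  m + ∑ M′ + (Mv + Mu)        ≡⟨ reassoc m (∑ M′) Mv Mu ⟩
  m + (∑ M′ + Mv + Mu)        ≤⟨ +-monoʳ-≤ m merged ⟩
  m + (∑ M + suc (Mu ⊔ Mv))   ≡⟨ shuffle m (∑ M) (Mu ⊔ Mv) ⟩
  suc (∑ M) + (m + (Mu ⊔ Mv)) ≤⟨ +-monoʳ-≤ (suc (∑ M)) (⊓-+-⊔-≤ (≤-classMax κ D refl)
                                                               (≤-classMax κ D refl)) ⟩
  suc (∑ M) + (Mu + Mv)       ≡⟨ cong (suc (∑ M) +_) (+-comm Mu Mv) ⟩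
  suc (∑ M) + (Mv + Mu)       ∎)
  where
    open ≤-Reasoning
    D : Fin _ → ℕ
    D = deg G
    M M′ : Vector ℕ _
    M  = classMax κ D
    M′ = classMax (merge κ u v) (deg (G ++ (u , v) ∷ []))
    Mu Mv m : ℕ
    Mu = M (κ u)
    Mv = M (κ v)
    m = D u ⊓ D v
    κu≢κv : κ u ≢ κ v
    κu≢κv = u≁v ∘ classes
    merged : ∑ M′ + Mv + Mu ≤ ∑ M + suc (Mu ⊔ Mv)
    merged = ∑-merge-≤ M M′ (κu≢κv ∘ sym)
      (classMax-merge-target κ D _ (deg-snoc-≤ G (κu≢κv ∘ cong κ)))
      (classMax-merge-absorbed κ _ κu≢κv)
      (λ c c≢κu c≢κv → classMax-merge-other κ D _ c≢κu c≢κv (λ x → deg-snoc-≢ G))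
    reassoc : ∀ a b c d → a + b + (c + d) ≡ a + (b + c + d)
    reassoc = solve-∀
    shuffle : ∀ a s c → a + (s + suc c) ≡ suc s + (a + c)
    shuffle = solve-∀

potential-[] : ∀ (κ : Fin n → Fin n) → potential [] κ ≡ 0
potential-[] {n} κ = n≤0⇒n≡0 (begin
  potential [] κ        ≤⟨ ∑-mono-≤ {n} (λ c → classMax-lub κ (deg []) (λ _ _ → z≤n)) ⟩
  ∑ (λ (_ : Fin n) → 0) ≡⟨ sum-replicate-zero n ⟩
  0                     ∎)
  where open ≤-Reasoning

costFrom : Graph n → List (Edge n) → ℕ
costFrom G []       = 0
costFrom G (e ∷ es) = edgeCost G e + costFrom (G ++ e ∷ []) es

JoinsTreesAfter : Graph n → List (Edge n) → Set
JoinsTreesAfter G es = ∀ i →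
  ¬ Connected (G ++ take (toℕ i) es) (proj₁ (lookup es i)) (proj₂ (lookup es i))

costFrom-≤ : ∀ {κ} es → ConnectedClasses G κ → JoinsTreesAfter G es →
             costFrom G es ≤ potential G κ + length es
costFrom-≤ []                         _       _     = z≤n
costFrom-≤ {G = G} {κ} ((u , v) ∷ es) classes joins = begin
  c + costFrom G′ es                 ≤⟨ +-monoʳ-≤ c (costFrom-≤ es (ConnectedClasses-merge classes) joins′) ⟩
  c + (potential G′ κ′ + length es)  ≡⟨ +-assoc c (potential G′ κ′) (length es) ⟨
  c + potential G′ κ′ + length es    ≤⟨ +-monoˡ-≤ (length es) (potential-merge classes u≁v) ⟩
  suc (potential G κ) + length es    ≡⟨ +-suc (potential G κ) (length es) ⟨
  potential G κ + suc (length es)    ∎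
  where
    open ≤-Reasoning
    c : ℕ
    c = edgeCost G (u , v)
    G′ : Graph _
    G′ = G ++ (u , v) ∷ []
    κ′ : Fin _ → Fin _
    κ′ = merge κ u v
    u≁v : ¬ Connected G u v
    u≁v = joins zero ∘ subst (λ H → Connected H u v) (sym (++-identityʳ G))
    joins′ : JoinsTreesAfter G′ es
    joins′ i = joins (suc i) ∘ subst (λ H → Connected H _ _) (++-assoc G _ _)

sum-edgeCosts≡costFrom : ∀ (G : Graph n) es →
  sum (tabulate (λ i → edgeCost (G ++ take (toℕ i) es) (lookup es i))) ≡ costFrom G es
sum-edgeCosts≡costFrom G []       = refl
sum-edgeCosts≡costFrom G (e ∷ es) = cong₂ _+_
  (cong (λ H → edgeCost H e) (++-identityʳ G))
  (trans (cong sum (tabulate-cong (λ i → cong (λ H → edgeCost H (lookup es i)) (shift (toℕ i)))))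
         (sum-edgeCosts≡costFrom (G ++ e ∷ []) es))
  where
    shift : ∀ i → G ++ e ∷ take i es ≡ (G ++ e ∷ []) ++ take i es
    shift i = sym (++-assoc G (e ∷ []) (take i es))

totalCost≡costFrom : ∀ (es : List (Edge n)) → totalCost es ≡ costFrom [] es
totalCost≡costFrom es = trans (cong sum (map-tabulate id (cost es))) (sum-edgeCosts≡costFrom [] es)

proposition4p14 : (n : ℕ) (es : List (Edge n)) → ValidInsertions es → totalCost es ≤ length es
proposition4p14 n es valid = begin
  totalCost es                    ≡⟨ totalCost≡costFrom es ⟩
  costFrom [] es                  ≤⟨ costFrom-≤ {κ = id} es (λ { refl → here }) valid ⟩
  potential {n} [] id + length es ≡⟨ cong (_+ length es) (potential-[] {n} id) ⟩
  length es                       ∎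
  where open ≤-Reasoning
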